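{- Let $A=\bigoplus_{i\ge0}A_i$ be a commutative algebra over a field $\mathbb F$ with $A_0=\mathbb F$, filtered in the sense that $A_iA_j\subseteq\bigoplus_{k\ge i+j}A_k$, and with $A_1$ one-dimensional spanned by $g$. Let $A_+=\bigoplus_{i\ge1}A_i$. Let $\Delta:A\to A\otimes A$ be a unital algebra homomorphism such that $\Delta(a)-1\otimes a-a\otimes 1\in A_+\otimes A_+$ for every $a\in A_+$. Let $\xi:A\otimes A\to A$ be a linear map with $\xi(p\otimes g)=p$ for all $p\in A$ and $\xi(p\otimes q)=0$ whenever $q\in A_i$ with $i\ne1$. Then $D(a)=\xi(\Delta(a))$ is a derivation of $A$. -}

module Defs where

open import Level using (Level; _⊔_) renaming (suc to lsuc)
open import Data.Nat as ℕ using (ℕ)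
open import Data.Product using (Σ; _×_; _,_)
open import Data.List using (List; []; _∷_)
open import Data.List.Relation.Unary.All using (All)
open import Relation.Nullary using (¬_)
open import Relation.Binary.PropositionalEquality using (_≢_)
open import Algebra.Bundles using (CommutativeRing)
open import Algebra.Module.Bundles using (Module)
open import Algebra.Morphism.Structures using (module RingMorphisms)

record IsField {c ℓ} (F : CommutativeRing c ℓ) : Set (c ⊔ ℓ) where
  open CommutativeRing F
  field
    0≉1     : ¬ (0# ≈ 1#)
    inverse : ∀ x → ¬ (x ≈ 0#) → Σ Carrier λ y → x * y ≈ 1#

record CommAlgebra {c ℓ} (F : CommutativeRing c ℓ) (a ℓa : Level)
       : Set (c ⊔ ℓ ⊔ lsuc (a ⊔ ℓa)) where
  field
    commRing : CommutativeRing a ℓa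
    ι     : CommutativeRing.Carrier F → CommutativeRing.Carrier commRing
    ι-hom : RingMorphisms.IsRingHomomorphism
              (CommutativeRing.rawRing F) (CommutativeRing.rawRing commRing) ι
  open CommutativeRing commRing public

  infixr 7 _·_
  _·_ : CommutativeRing.Carrier F → Carrier → Carrier
  k · x = ι k * x

module _ {c ℓ} {F : CommutativeRing c ℓ} where
  private module F = CommutativeRing F

  record IsLinear {a ℓa b ℓb} (A : CommAlgebra F a ℓa) (B : CommAlgebra F b ℓb)
         (f : CommAlgebra.Carrier A → CommAlgebra.Carrier B) : Set (c ⊔ a ⊔ ℓa ⊔ ℓb) where
    private
      module A = CommAlgebra A
      module B = CommAlgebra B
    field
      cong  : ∀ {x y} → x A.≈ y → f x B.≈ f y
      +-hom : ∀ x y → f (x A.+ y) B.≈ f x B.+ f y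
      ·-hom : ∀ k x → f (k A.· x) B.≈ k B.· f x

  record IsAlgebraHom {a ℓa b ℓb} (A : CommAlgebra F a ℓa) (B : CommAlgebra F b ℓb)
         (f : CommAlgebra.Carrier A → CommAlgebra.Carrier B) : Set (c ⊔ a ⊔ ℓa ⊔ ℓb) where
    private
      module A = CommAlgebra A
      module B = CommAlgebra B
    field
      ring-hom : RingMorphisms.IsRingHomomorphism A.rawRing B.rawRing f
      ι-comm   : ∀ k → f (A.ι k) B.≈ B.ι k

  record IsDerivation {a ℓa} (A : CommAlgebra F a ℓa)
         (D : CommAlgebra.Carrier A → CommAlgebra.Carrier A) : Set (c ⊔ a ⊔ ℓa) where
    private module A = CommAlgebra A
    field
      linear  : IsLinear A A D
      leibniz : ∀ x y → D (x A.* y) A.≈ (x A.* D y) A.+ (D x A.* y)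

  module _ {a ℓa w ℓw} (A : CommAlgebra F a ℓa) (W : Module F w ℓw) where
    private
      module A = CommAlgebra A
      module W = Module W

    record IsBilinear (f : A.Carrier → A.Carrier → W.Carrierᴹ) : Set (c ⊔ a ⊔ ℓa ⊔ w ⊔ ℓw) where
      field
        cong   : ∀ {x x' y y'} → x A.≈ x' → y A.≈ y' → f x y W.≈ᴹ f x' y'
        +-homˡ : ∀ x x' y → f (x A.+ x') y W.≈ᴹ f x y W.+ᴹ f x' y
        +-homʳ : ∀ x y y' → f x (y A.+ y') W.≈ᴹ f x y W.+ᴹ f x y'
        ·-homˡ : ∀ k x y → f (k A.· x) y W.≈ᴹ k W.*ₗ f x y
        ·-homʳ : ∀ k x y → f x (k A.· y) W.≈ᴹ k W.*ₗ f x y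

    record IsLinearToModule (h : A.Carrier → W.Carrierᴹ) : Set (c ⊔ a ⊔ ℓa ⊔ w ⊔ ℓw) where
      field
        cong  : ∀ {x y} → x A.≈ y → h x W.≈ᴹ h y
        +-hom : ∀ x y → h (x A.+ y) W.≈ᴹ h x W.+ᴹ h y
        ·-hom : ∀ k x → h (k A.· x) W.≈ᴹ k W.*ₗ h x

  record IsTensorSquare {a ℓa t ℓt} (A : CommAlgebra F a ℓa) (T : CommAlgebra F t ℓt)
         (_⊗_ : CommAlgebra.Carrier A → CommAlgebra.Carrier A → CommAlgebra.Carrier T)
         : Set (lsuc (c ⊔ ℓ ⊔ a ⊔ ℓa ⊔ t ⊔ ℓt)) where
    private
      module A = CommAlgebra A
      module T = CommAlgebra T
    field
      ⊗-cong   : ∀ {x x' y y'} → x A.≈ x' → y A.≈ y' → (x ⊗ y) T.≈ (x' ⊗ y')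
      ⊗-+ˡ     : ∀ x x' y → ((x A.+ x') ⊗ y) T.≈ ((x ⊗ y) T.+ (x' ⊗ y))
      ⊗-+ʳ     : ∀ x y y' → (x ⊗ (y A.+ y')) T.≈ ((x ⊗ y) T.+ (x ⊗ y'))
      ⊗-·ˡ     : ∀ k x y → ((k A.· x) ⊗ y) T.≈ (k T.· (x ⊗ y))
      ⊗-·ʳ     : ∀ k x y → (x ⊗ (k A.· y)) T.≈ (k T.· (x ⊗ y))
      ⊗-*      : ∀ x y x' y' → ((x ⊗ y) T.* (x' ⊗ y')) T.≈ ((x A.* x') ⊗ (y A.* y'))
      ⊗-1      : (A.1# ⊗ A.1#) T.≈ T.1#
      universal : (W : Module F t ℓt) (f : A.Carrier → A.Carrier → Module.Carrierᴹ W) →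
                  IsBilinear A W f →
                  Σ (T.Carrier → Module.Carrierᴹ W) λ h →
                    IsLinearToModule T W h × (∀ x y → Module._≈ᴹ_ W (h (x ⊗ y)) (f x y))
      unique    : (W : Module F t ℓt) (h h' : T.Carrier → Module.Carrierᴹ W) →
                  IsLinearToModule T W h → IsLinearToModule T W h' →
                  (∀ x y → Module._≈ᴹ_ W (h (x ⊗ y)) (h' (x ⊗ y))) →
                  ∀ z → Module._≈ᴹ_ W (h z) (h' z)

  -- A = ⊕_{i ≥ 0} A_i is encoded by the family of projections
  -- π i : A → A_i ⊆ A (an internal direct sum: the π i are linear,
  -- idempotent, pairwise orthogonal, and every x is the finite sum of its
  -- components).

  module _ {a ℓa} (A : CommAlgebra F a ℓa) where
    private module A = CommAlgebra A

    sumUpTo : ℕ → (ℕ → A.Carrier) → A.Carrier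
    sumUpTo ℕ.zero    f = f ℕ.zero
    sumUpTo (ℕ.suc n) f = sumUpTo n f A.+ f (ℕ.suc n)

    InGrade : (ℕ → A.Carrier → A.Carrier) → ℕ → A.Carrier → Set ℓa
    InGrade π i x = π i x A.≈ x

    InA₊ : (ℕ → A.Carrier → A.Carrier) → A.Carrier → Set ℓa
    InA₊ π x = π 0 x A.≈ A.0#

    record IsConnectedFilteredGraded (π : ℕ → A.Carrier → A.Carrier) (g : A.Carrier)
           : Set (c ⊔ a ⊔ ℓa) where
      field
        π-linear   : ∀ i → IsLinear A A (π i)
        π-idem     : ∀ i x → π i (π i x) A.≈ π i x
        π-orth     : ∀ i j x → i ≢ j → π i (π j x) A.≈ A.0#
        π-finite   : ∀ x → Σ ℕ λ N →
                       (∀ i → N ℕ.< i → π i x A.≈ A.0#) × (x A.≈ sumUpTo N (λ i → π i x))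
        grade0-ι   : ∀ k → InGrade π 0 (A.ι k)
        grade0     : ∀ x → InGrade π 0 x → Σ (CommutativeRing.Carrier F) λ k → x A.≈ A.ι k
        g-grade1   : InGrade π 1 g
        g≉0        : ¬ (g A.≈ A.0#)
        grade1     : ∀ x → InGrade π 1 x → Σ (CommutativeRing.Carrier F) λ k → x A.≈ (k A.· g)
        filtered   : ∀ i j k x y → InGrade π i x → InGrade π j y → k ℕ.< i ℕ.+ j →
                       π k (x A.* y) A.≈ A.0#

  module _ {a ℓa t ℓt} (A : CommAlgebra F a ℓa) (T : CommAlgebra F t ℓt)
           (_⊗_ : CommAlgebra.Carrier A → CommAlgebra.Carrier A → CommAlgebra.Carrier T)
           (π : ℕ → CommAlgebra.Carrier A → CommAlgebra.Carrier A) where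
    private
      module A = CommAlgebra A
      module T = CommAlgebra T

    sumPure : List (A.Carrier × A.Carrier) → T.Carrier
    sumPure []             = T.0#
    sumPure ((p , q) ∷ ps) = (p ⊗ q) T.+ sumPure ps

    InA₊⊗A₊ : T.Carrier → Set (a ⊔ ℓa ⊔ ℓt)
    InA₊⊗A₊ z = Σ (List (A.Carrier × A.Carrier)) λ ps →
                  All (λ pq → InA₊ A π (Data.Product.proj₁ pq) × InA₊ A π (Data.Product.proj₂ pq)) ps
                  × (z T.≈ sumPure ps)

    IsPrimitiveModuloA₊⊗A₊ : (A.Carrier → T.Carrier) → Set (a ⊔ ℓa ⊔ ℓt)
    IsPrimitiveModuloA₊⊗A₊ Δ =
      ∀ x → InA₊ A π x → InA₊⊗A₊ ((Δ x T.- (A.1# ⊗ x)) T.- (x ⊗ A.1#))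

-- Since ξ (p ⊗ g) = p and ξ kills p ⊗ A_i for i ≠ 1, one has ξ (p ⊗ q) = p · δ q with
-- δ q = ξ (1 ⊗ q) the g-coordinate of the degree-one part of q.  The filtration makes
-- A₊ A₊ miss degree one, so δ is a point derivation at the augmentation ε = π₀:
-- δ (x y) = ε x · δ y + δ x · ε y.  Writing Δ x = Σ pᵢ ⊗ qᵢ, the hypothesis on Δ gives
-- the counit law Σ pᵢ · ε qᵢ = x, while D x = Σ pᵢ · δ qᵢ; multiplicativity of Δ then
-- turns the product rule of δ into the Leibniz rule for D.
module Submission where

open import Defs
open import Level using (Level)
open import Data.Nat using (ℕ; zero; suc; s≤s; z≤n)
open import Data.Nat.Properties using (≤-trans; m≤n+m)
open import Data.Product using (Σ; _×_; _,_; proj₁; proj₂)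
open import Data.List using (List; []; _∷_)
open import Data.List.Relation.Unary.All using (All; []; _∷_)
open import Data.Maybe using (nothing)
open import Relation.Binary.PropositionalEquality as ≡ using (_≢_)
open import Algebra.Bundles using (CommutativeRing)
open import Algebra.Morphism.Structures using (module RingMorphisms)
import Algebra.Properties.AbelianGroup as AbelianGroupProperties
import Algebra.Properties.CommutativeSemigroup as CommutativeSemigroupProperties
import Relation.Binary.Reasoning.Setoid as SetoidReasoning
open import Tactic.RingSolver using (solve-∀)
open import Tactic.RingSolver.Core.AlmostCommutativeRing using (AlmostCommutativeRing; fromCommutativeRing)

module _ {a ℓ} (R : CommutativeRing a ℓ) where
  -- Without a zero test the solver cannot cancel x - x, so it is used only for
  -- cancellation-free identities.
  private
    almostCommutativeRing : AlmostCommutativeRing a ℓ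
    almostCommutativeRing = fromCommutativeRing R (λ _ → nothing)

  open AlmostCommutativeRing almostCommutativeRing

  +-*-interchange : ∀ a b c d x y →
                    (a * x + b * y) + (c * x + d * y) ≈ (a + c) * x + (b + d) * y
  +-*-interchange = solve-∀ almostCommutativeRing

  product-expansion : ∀ p p' e l e' l' Λ E →
                      (p * p') * (e * l' + l * e') + ((p * e) * Λ + (p * l) * E)
                      ≈ (p * e) * (p' * l' + Λ) + (p * l) * (p' * e' + E)
  product-expansion = solve-∀ almostCommutativeRing

module _ {c ℓ} {F : CommutativeRing c ℓ} where

  module LinearMap {a ℓa b ℓb} {A : CommAlgebra F a ℓa} {B : CommAlgebra F b ℓb}
                   {f : CommAlgebra.Carrier A → CommAlgebra.Carrier B} (L : IsLinear A B f) where
    private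
      module A = CommAlgebra A
      module B = CommAlgebra B
    open IsLinear L

    0#-homo : f A.0# B.≈ B.0#
    0#-homo = AbelianGroupProperties.identityˡ-unique B.+-abelianGroup (f A.0#) (f A.0#)
                (B.trans (B.sym (+-hom A.0# A.0#)) (cong (A.+-identityˡ A.0#)))

    -‿homo : ∀ x → f (A.- x) B.≈ B.- f x
    -‿homo x = AbelianGroupProperties.inverseˡ-unique B.+-abelianGroup (f (A.- x)) (f x)
                 (B.trans (B.sym (+-hom (A.- x) x)) (B.trans (cong (A.-‿inverseˡ x)) 0#-homo))

  ∘-linear : ∀ {a ℓa b ℓb d ℓd} {A : CommAlgebra F a ℓa} {B : CommAlgebra F b ℓb}
               {C : CommAlgebra F d ℓd} {h : CommAlgebra.Carrier B → CommAlgebra.Carrier C}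
               {f : CommAlgebra.Carrier A → CommAlgebra.Carrier B} →
             IsLinear B C h → IsLinear A B f → IsLinear A C (λ x → h (f x))
  ∘-linear {C = C} H L = record
    { cong  = λ x≈y → H.cong (L.cong x≈y)
    ; +-hom = λ x y → C.trans (H.cong (L.+-hom x y)) (H.+-hom _ _)
    ; ·-hom = λ k x → C.trans (H.cong (L.·-hom k x)) (H.·-hom k _)
    }
    where
    module C = CommAlgebra C
    module H = IsLinear H
    module L = IsLinear L

  algebraHom-linear : ∀ {a ℓa b ℓb} {A : CommAlgebra F a ℓa} {B : CommAlgebra F b ℓb}
                        {f : CommAlgebra.Carrier A → CommAlgebra.Carrier B} →
                      IsAlgebraHom A B f → IsLinear A B f
  algebraHom-linear {A = A} {B} H = record
    { cong  = ⟦⟧-cong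
    ; +-hom = +-homo
    ; ·-hom = λ k x → B.trans (*-homo (A.ι k) x) (B.*-congʳ (IsAlgebraHom.ι-comm H k))
    }
    where
    module A = CommAlgebra A
    module B = CommAlgebra B
    open RingMorphisms.IsRingHomomorphism (IsAlgebraHom.ring-hom H)

  module _ {a ℓa} (A : CommAlgebra F a ℓa) where
    open CommAlgebra A

    *-linearˡ : ∀ u → IsLinear A A (u *_)
    *-linearˡ u = record
      { cong  = *-congˡ
      ; +-hom = distribˡ u
      ; ·-hom = λ k x → CommutativeSemigroupProperties.x∙yz≈y∙xz *-commutativeSemigroup u (ι k) x
      }

    *-linearʳ : ∀ u → IsLinear A A (_* u)
    *-linearʳ u = record
      { cong  = *-congʳ
      ; +-hom = λ x y → distribʳ u x y
      ; ·-hom = λ k x → *-assoc (ι k) x u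
      }

    x≈y+[x-y] : ∀ x y → x ≈ y + (x - y)
    x≈y+[x-y] x y = sym (trans (sym (+-assoc y x (- y)))
                              (AbelianGroupProperties.xyx⁻¹≈y +-abelianGroup y x))

    contract : (Carrier → Carrier) → List (Carrier × Carrier) → Carrier
    contract f []             = 0#
    contract f ((p , q) ∷ ps) = p * f q + contract f ps

  module Grading {a ℓa} {A : CommAlgebra F a ℓa} {π : ℕ → CommAlgebra.Carrier A → CommAlgebra.Carrier A}
                 {g : CommAlgebra.Carrier A} (G : IsConnectedFilteredGraded A π g) where
    open CommAlgebra A
    open IsConnectedFilteredGraded G

    graded-ext : ∀ {b ℓb} {B : CommAlgebra F b ℓb} {f h : Carrier → CommAlgebra.Carrier B} →
                 IsLinear A B f → IsLinear A B h →
                 (∀ i x → CommAlgebra._≈_ B (f (π i x)) (h (π i x))) →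
                 ∀ x → CommAlgebra._≈_ B (f x) (h x)
    graded-ext {B = B} {f} {h} Lf Lh agree x with π-finite x
    ... | N , _ , x≈Σπx = B.trans (Lf.cong x≈Σπx) (B.trans (agreeUpTo N) (Lh.cong (sym x≈Σπx)))
      where
      module B = CommAlgebra B
      module Lf = IsLinear Lf
      module Lh = IsLinear Lh
      agreeUpTo : ∀ n → f (sumUpTo A n (λ i → π i x)) B.≈ h (sumUpTo A n (λ i → π i x))
      agreeUpTo zero    = agree 0 x
      agreeUpTo (suc n) = B.trans (Lf.+-hom _ _)
                            (B.trans (B.+-cong (agreeUpTo n) (agree (suc n) x)) (B.sym (Lh.+-hom _ _)))

    linear-vanishes-on-A₊ : ∀ {b ℓb} {B : CommAlgebra F b ℓb} {f : Carrier → CommAlgebra.Carrier B} →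
                            IsLinear A B f →
                            (∀ i x → InGrade A π (suc i) x → CommAlgebra._≈_ B (f x) (CommAlgebra.0# B)) →
                            ∀ x → InA₊ A π x → CommAlgebra._≈_ B (f x) (CommAlgebra.0# B)
    linear-vanishes-on-A₊ {B = B} {f} Lf vanish x x∈A₊ =
      B.trans (graded-ext Lf (∘-linear Lf (π-linear 0)) agree x)
              (B.trans (Lf.cong x∈A₊) (LinearMap.0#-homo Lf))
      where
      module B = CommAlgebra B
      module Lf = IsLinear Lf
      agree : ∀ i x → f (π i x) B.≈ f (π 0 (π i x))
      agree zero    x = Lf.cong (sym (π-idem 0 x))
      agree (suc i) x = B.trans (vanish i _ (π-idem (suc i) x))
                          (B.sym (B.trans (Lf.cong (π-orth 0 (suc i) x (λ ()))) (LinearMap.0#-homo Lf)))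

    π₁-*-A₊ : ∀ x y → InA₊ A π x → InA₊ A π y → π 1 (x * y) ≈ 0#
    π₁-*-A₊ x y x∈A₊ y∈A₊ =
      linear-vanishes-on-A₊ (∘-linear (π-linear 1) (*-linearʳ A y)) vanish x x∈A₊
      where
      vanish : ∀ i u → InGrade A π (suc i) u → π 1 (u * y) ≈ 0#
      vanish i u u∈Aᵢ₊₁ = linear-vanishes-on-A₊ (∘-linear (π-linear 1) (*-linearˡ A u))
        (λ j v v∈Aⱼ₊₁ → filtered (suc i) (suc j) 1 u v u∈Aᵢ₊₁ v∈Aⱼ₊₁
                          (s≤s (≤-trans (s≤s z≤n) (m≤n+m (suc j) i))))
        y y∈A₊

    1#∈A₀ : InGrade A π 0 1#
    1#∈A₀ = trans (πL.cong (sym 1#-homo)) (trans (grade0-ι F.1#) 1#-homo)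
      where
      module F = CommutativeRing F
      module πL = IsLinear (π-linear 0)
      open RingMorphisms.IsRingHomomorphism ι-hom using (1#-homo)

    π₀-scalar : ∀ x → Σ (CommutativeRing.Carrier F) λ k → π 0 x ≈ ι k
    π₀-scalar x = grade0 (π 0 x) (π-idem 0 x)

    x-π₀x∈A₊ : ∀ x → InA₊ A π (x - π 0 x)
    x-π₀x∈A₊ x = trans (πL.+-hom x (- π 0 x))
                   (trans (+-congˡ (trans (LinearMap.-‿homo (π-linear 0) (π 0 x)) (-‿cong (π-idem 0 x))))
                          (-‿inverseʳ (π 0 x)))
      where module πL = IsLinear (π-linear 0)

  module PointDerivation
      {a ℓa t ℓt} {A : CommAlgebra F a ℓa} {π : ℕ → CommAlgebra.Carrier A → CommAlgebra.Carrier A}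
      {g : CommAlgebra.Carrier A} (G : IsConnectedFilteredGraded A π g)
      {T : CommAlgebra F t ℓt} {_⊗_ : CommAlgebra.Carrier A → CommAlgebra.Carrier A → CommAlgebra.Carrier T}
      (TS : IsTensorSquare A T _⊗_)
      {ξ : CommAlgebra.Carrier T → CommAlgebra.Carrier A} (ξL : IsLinear T A ξ)
      (ξ-⊗-g : ∀ p → CommAlgebra._≈_ A (ξ (p ⊗ g)) p)
      (ξ-⊗-Aᵢ : ∀ i p q → i ≢ 1 → InGrade A π i q → CommAlgebra._≈_ A (ξ (p ⊗ q)) (CommAlgebra.0# A))
    where
    open CommAlgebra A
    open IsConnectedFilteredGraded G
    open IsTensorSquare TS
    open Grading G
    open SetoidReasoning setoid
    private
      module T = CommAlgebra T
      module ξL = IsLinear ξL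

    ⊗-linearʳ : ∀ p → IsLinear A T (p ⊗_)
    ⊗-linearʳ p = record { cong = ⊗-cong refl ; +-hom = ⊗-+ʳ p ; ·-hom = λ k q → ⊗-·ʳ k p q }

    ξ-⊗-0# : ∀ p → ξ (p ⊗ 0#) ≈ 0#
    ξ-⊗-0# p = ξ-⊗-Aᵢ 0 p 0# (λ ()) (LinearMap.0#-homo (π-linear 0))

    ξ-⊗-π₁ : ∀ p q → ξ (p ⊗ q) ≈ ξ (p ⊗ π 1 q)
    ξ-⊗-π₁ p = graded-ext (∘-linear ξL (⊗-linearʳ p)) (∘-linear ξL (∘-linear (⊗-linearʳ p) (π-linear 1))) agree
      where
      vanish : ∀ i q → i ≢ 1 → ξ (p ⊗ π i q) ≈ ξ (p ⊗ π 1 (π i q))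
      vanish i q i≢1 = trans (ξ-⊗-Aᵢ i p _ i≢1 (π-idem i q))
                         (sym (trans (ξL.cong (⊗-cong refl (π-orth 1 i q (λ 1≡i → i≢1 (≡.sym 1≡i)))))
                                     (ξ-⊗-0# p)))
      agree : ∀ i q → ξ (p ⊗ π i q) ≈ ξ (p ⊗ π 1 (π i q))
      agree 0             q = vanish 0 q (λ ())
      agree 1             q = ξL.cong (⊗-cong refl (sym (π-idem 1 q)))
      agree (suc (suc i)) q = vanish (suc (suc i)) q (λ ())

    δ : Carrier → Carrier
    δ q = ξ (1# ⊗ q)

    δ-linear : IsLinear A A δ
    δ-linear = ∘-linear ξL (⊗-linearʳ 1#)

    private module δL = IsLinear δ-linear

    ξ-⊗-coordinate : ∀ k q → π 1 q ≈ k · g → ∀ p → ξ (p ⊗ q) ≈ ι k * p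
    ξ-⊗-coordinate k q π₁q≈kg p = begin
      ξ (p ⊗ q)             ≈⟨ ξ-⊗-π₁ p q ⟩
      ξ (p ⊗ π 1 q)         ≈⟨ ξL.cong (⊗-cong refl π₁q≈kg) ⟩
      ξ (p ⊗ (k · g))       ≈⟨ ξL.cong (⊗-·ʳ k p g) ⟩
      ξ (k T.· (p ⊗ g))     ≈⟨ ξL.·-hom k (p ⊗ g) ⟩
      ι k * ξ (p ⊗ g)       ≈⟨ *-congˡ (ξ-⊗-g p) ⟩
      ι k * p               ∎

    ξ-⊗ : ∀ p q → ξ (p ⊗ q) ≈ p * δ q
    ξ-⊗ p q with grade1 (π 1 q) (π-idem 1 q)
    ... | k , π₁q≈kg = begin
      ξ (p ⊗ q)       ≈⟨ ξ-⊗-coordinate k q π₁q≈kg p ⟩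
      ι k * p         ≈⟨ *-comm (ι k) p ⟩
      p * ι k         ≈⟨ *-congˡ (sym (*-identityʳ (ι k))) ⟩
      p * (ι k * 1#)  ≈⟨ *-congˡ (sym (ξ-⊗-coordinate k q π₁q≈kg 1#)) ⟩
      p * δ q         ∎

    δ-A₀ : ∀ q → InGrade A π 0 q → δ q ≈ 0#
    δ-A₀ q = ξ-⊗-Aᵢ 0 1# q (λ ())

    δ-A₊-part : ∀ x → δ (x - π 0 x) ≈ δ x
    δ-A₊-part x = sym (begin
      δ x                           ≈⟨ δL.cong (x≈y+[x-y] A x (π 0 x)) ⟩
      δ (π 0 x + (x - π 0 x))       ≈⟨ δL.+-hom (π 0 x) _ ⟩
      δ (π 0 x) + δ (x - π 0 x)     ≈⟨ +-congʳ (δ-A₀ (π 0 x) (π-idem 0 x)) ⟩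
      0# + δ (x - π 0 x)            ≈⟨ +-identityˡ _ ⟩
      δ (x - π 0 x)                 ∎)

    δ-π₀-* : ∀ x y → δ (π 0 x * y) ≈ π 0 x * δ y
    δ-π₀-* x y with π₀-scalar x
    ... | k , π₀x≈ιk = begin
      δ (π 0 x * y)  ≈⟨ δL.cong (*-congʳ π₀x≈ιk) ⟩
      δ (ι k * y)    ≈⟨ δL.·-hom k y ⟩
      ι k * δ y      ≈⟨ *-congʳ (sym π₀x≈ιk) ⟩
      π 0 x * δ y    ∎

    δ-A₊-* : ∀ x y → InA₊ A π x → InA₊ A π y → δ (x * y) ≈ 0#
    δ-A₊-* x y x∈A₊ y∈A₊ =
      trans (ξ-⊗-π₁ 1# (x * y)) (trans (ξL.cong (⊗-cong refl (π₁-*-A₊ x y x∈A₊ y∈A₊))) (ξ-⊗-0# 1#))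

    δ-*-A₊ : ∀ x y → InA₊ A π y → δ (x * y) ≈ π 0 x * δ y
    δ-*-A₊ x y y∈A₊ = begin
      δ (x * y)                                ≈⟨ δL.cong (*-congʳ (x≈y+[x-y] A x (π 0 x))) ⟩
      δ ((π 0 x + (x - π 0 x)) * y)            ≈⟨ δL.cong (distribʳ y _ _) ⟩
      δ (π 0 x * y + (x - π 0 x) * y)          ≈⟨ δL.+-hom _ _ ⟩
      δ (π 0 x * y) + δ ((x - π 0 x) * y)      ≈⟨ +-cong (δ-π₀-* x y) (δ-A₊-* _ y (x-π₀x∈A₊ x) y∈A₊) ⟩
      π 0 x * δ y + 0#                         ≈⟨ +-identityʳ _ ⟩
      π 0 x * δ y                              ∎

    δ-* : ∀ x y → δ (x * y) ≈ π 0 x * δ y + δ x * π 0 y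
    δ-* x y = begin
      δ (x * y)                                ≈⟨ δL.cong (*-congˡ (x≈y+[x-y] A y (π 0 y))) ⟩
      δ (x * (π 0 y + (y - π 0 y)))            ≈⟨ δL.cong (distribˡ x _ _) ⟩
      δ (x * π 0 y + x * (y - π 0 y))          ≈⟨ δL.+-hom _ _ ⟩
      δ (x * π 0 y) + δ (x * (y - π 0 y))      ≈⟨ +-cong (δL.cong (*-comm x (π 0 y))) (δ-*-A₊ x _ (x-π₀x∈A₊ y)) ⟩
      δ (π 0 y * x) + π 0 x * δ (y - π 0 y)    ≈⟨ +-cong (δ-π₀-* y x) (*-congˡ (δ-A₊-part y)) ⟩
      π 0 y * δ x + π 0 x * δ y                ≈⟨ +-comm _ _ ⟩
      π 0 x * δ y + π 0 y * δ x                ≈⟨ +-congˡ (*-comm (π 0 y) (δ x)) ⟩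
      π 0 x * δ y + δ x * π 0 y                ∎

    private
      S : List (Carrier × Carrier) → T.Carrier
      S = sumPure A T _⊗_ π

    ξ-sumPure : ∀ ps → ξ (S ps) ≈ contract A δ ps
    ξ-sumPure []             = LinearMap.0#-homo ξL
    ξ-sumPure ((p , q) ∷ ps) =
      trans (ξL.+-hom (p ⊗ q) (S ps)) (+-cong (ξ-⊗ p q) (ξ-sumPure ps))

    ξ-⊗-*-sumPure : ∀ p q qs → ξ ((p ⊗ q) T.* S qs)
                    ≈ (p * π 0 q) * contract A δ qs + (p * δ q) * contract A (π 0) qs
    ξ-⊗-*-sumPure p q [] = begin
      ξ ((p ⊗ q) T.* T.0#)                 ≈⟨ trans (ξL.cong (T.zeroʳ _)) (LinearMap.0#-homo ξL) ⟩
      0#                                   ≈⟨ sym (+-identityʳ 0#) ⟩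
      0# + 0#                              ≈⟨ sym (+-cong (zeroʳ _) (zeroʳ _)) ⟩
      (p * π 0 q) * 0# + (p * δ q) * 0#    ∎
    ξ-⊗-*-sumPure p q ((p' , q') ∷ qs) = begin
      ξ ((p ⊗ q) T.* ((p' ⊗ q') T.+ S qs))
        ≈⟨ trans (ξL.cong (T.distribˡ _ _ _)) (ξL.+-hom _ _) ⟩
      ξ ((p ⊗ q) T.* (p' ⊗ q')) + ξ ((p ⊗ q) T.* S qs)
        ≈⟨ +-cong (trans (ξL.cong (⊗-* p q p' q')) (ξ-⊗ _ _)) (ξ-⊗-*-sumPure p q qs) ⟩
      (p * p') * δ (q * q') + ((p * π 0 q) * contract A δ qs + (p * δ q) * contract A (π 0) qs)
        ≈⟨ +-congʳ (*-congˡ (δ-* q q')) ⟩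
      (p * p') * (π 0 q * δ q' + δ q * π 0 q')
        + ((p * π 0 q) * contract A δ qs + (p * δ q) * contract A (π 0) qs)
        ≈⟨ product-expansion commRing p p' (π 0 q) (δ q) (π 0 q') (δ q') _ _ ⟩
      (p * π 0 q) * (p' * δ q' + contract A δ qs) + (p * δ q) * (p' * π 0 q' + contract A (π 0) qs)
        ∎

    ξ-sumPure-* : ∀ ps qs → ξ (S ps T.* S qs)
                  ≈ contract A (π 0) ps * contract A δ qs + contract A δ ps * contract A (π 0) qs
    ξ-sumPure-* [] qs = begin
      ξ (T.0# T.* S qs)                                  ≈⟨ trans (ξL.cong (T.zeroˡ _)) (LinearMap.0#-homo ξL) ⟩
      0#                                                 ≈⟨ sym (+-identityʳ 0#) ⟩
      0# + 0#                                            ≈⟨ sym (+-cong (zeroˡ _) (zeroˡ _)) ⟩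
      0# * contract A δ qs + 0# * contract A (π 0) qs    ∎
    ξ-sumPure-* ((p , q) ∷ ps) qs = begin
      ξ (((p ⊗ q) T.+ S ps) T.* S qs)
        ≈⟨ trans (ξL.cong (T.distribʳ _ _ _)) (ξL.+-hom _ _) ⟩
      ξ ((p ⊗ q) T.* S qs) + ξ (S ps T.* S qs)
        ≈⟨ +-cong (ξ-⊗-*-sumPure p q qs) (ξ-sumPure-* ps qs) ⟩
      ((p * π 0 q) * contract A δ qs + (p * δ q) * contract A (π 0) qs)
        + (contract A (π 0) ps * contract A δ qs + contract A δ ps * contract A (π 0) qs)
        ≈⟨ +-*-interchange commRing _ _ _ _ _ _ ⟩
      contract A (π 0) ((p , q) ∷ ps) * contract A δ qs + contract A δ ((p , q) ∷ ps) * contract A (π 0) qs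
        ∎

  module CounitPresentation
      {a ℓa t ℓt} {A : CommAlgebra F a ℓa} {π : ℕ → CommAlgebra.Carrier A → CommAlgebra.Carrier A}
      {g : CommAlgebra.Carrier A} (G : IsConnectedFilteredGraded A π g)
      {T : CommAlgebra F t ℓt} {_⊗_ : CommAlgebra.Carrier A → CommAlgebra.Carrier A → CommAlgebra.Carrier T}
      (TS : IsTensorSquare A T _⊗_)
      {Δ : CommAlgebra.Carrier A → CommAlgebra.Carrier T} (ΔH : IsAlgebraHom A T Δ)
      (Δ-primitive : IsPrimitiveModuloA₊⊗A₊ A T _⊗_ π Δ)
    where
    open CommAlgebra A
    open IsConnectedFilteredGraded G
    open IsTensorSquare TS
    open Grading G
    open SetoidReasoning setoid
    private
      module T where
        open CommAlgebra T public
        open SetoidReasoning (CommAlgebra.setoid T) public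
      module ΔL = IsLinear (algebraHom-linear ΔH)

      S : List (Carrier × Carrier) → T.Carrier
      S = sumPure A T _⊗_ π

    Δ-ι : ∀ k → Δ (ι k) T.≈ (ι k ⊗ 1#)
    Δ-ι k = T.begin
      Δ (ι k)                T.≈⟨ IsAlgebraHom.ι-comm ΔH k ⟩
      T.ι k                  T.≈⟨ T.sym (T.*-identityʳ (T.ι k)) ⟩
      T.ι k T.* T.1#         T.≈⟨ T.*-congˡ (T.sym ⊗-1) ⟩
      k T.· (1# ⊗ 1#)        T.≈⟨ T.sym (⊗-·ˡ k 1# 1#) ⟩
      (ι k * 1#) ⊗ 1#        T.≈⟨ ⊗-cong (*-identityʳ (ι k)) refl ⟩
      ι k ⊗ 1#               T.∎

    contract-π₀-A₊ : ∀ ps → All (λ pq → InA₊ A π (proj₁ pq) × InA₊ A π (proj₂ pq)) ps →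
                     contract A (π 0) ps ≈ 0#
    contract-π₀-A₊ []             []                  = refl
    contract-π₀-A₊ ((p , q) ∷ ps) ((_ , q∈A₊) ∷ all) =
      trans (+-cong (trans (*-congˡ q∈A₊) (zeroʳ p)) (contract-π₀-A₊ ps all)) (+-identityʳ 0#)

    Δ-presentation-A₊ : ∀ x → InA₊ A π x → Σ (List (Carrier × Carrier)) λ ps →
                        (Δ x T.≈ S ps) × (contract A (π 0) ps ≈ x)
    Δ-presentation-A₊ x x∈A₊ with Δ-primitive x x∈A₊
    ... | ps , all , rest≈Sps = (1# , x) ∷ (x , 1#) ∷ ps , Δx≈ , counit
      where
      Δx≈ : Δ x T.≈ S ((1# , x) ∷ (x , 1#) ∷ ps)
      Δx≈ = T.begin
        Δ x
          T.≈⟨ x≈y+[x-y] T (Δ x) (1# ⊗ x) ⟩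
        (1# ⊗ x) T.+ (Δ x T.- (1# ⊗ x))
          T.≈⟨ T.+-congˡ (x≈y+[x-y] T _ (x ⊗ 1#)) ⟩
        (1# ⊗ x) T.+ ((x ⊗ 1#) T.+ ((Δ x T.- (1# ⊗ x)) T.- (x ⊗ 1#)))
          T.≈⟨ T.+-congˡ (T.+-congˡ rest≈Sps) ⟩
        (1# ⊗ x) T.+ ((x ⊗ 1#) T.+ S ps)
          T.∎
      counit : contract A (π 0) ((1# , x) ∷ (x , 1#) ∷ ps) ≈ x
      counit = begin
        1# * π 0 x + (x * π 0 1# + contract A (π 0) ps)
          ≈⟨ +-cong (trans (*-congˡ x∈A₊) (zeroʳ 1#))
                    (+-cong (trans (*-congˡ 1#∈A₀) (*-identityʳ x)) (contract-π₀-A₊ ps all)) ⟩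
        0# + (x + 0#)  ≈⟨ trans (+-identityˡ _) (+-identityʳ x) ⟩
        x              ∎

    Δ-presentation : ∀ x → Σ (List (Carrier × Carrier)) λ ps →
                     (Δ x T.≈ S ps) × (contract A (π 0) ps ≈ x)
    Δ-presentation x with π₀-scalar x | Δ-presentation-A₊ (x - π 0 x) (x-π₀x∈A₊ x)
    ... | k , π₀x≈ιk | ps , Δx₊≈Sps , counit₊ = (π 0 x , 1#) ∷ ps , Δx≈ , counit
      where
      Δx≈ : Δ x T.≈ S ((π 0 x , 1#) ∷ ps)
      Δx≈ = T.begin
        Δ x                              T.≈⟨ ΔL.cong (x≈y+[x-y] A x (π 0 x)) ⟩
        Δ (π 0 x + (x - π 0 x))          T.≈⟨ ΔL.+-hom _ _ ⟩
        Δ (π 0 x) T.+ Δ (x - π 0 x)      T.≈⟨ T.+-cong (ΔL.cong π₀x≈ιk) Δx₊≈Sps ⟩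
        Δ (ι k) T.+ S ps                 T.≈⟨ T.+-congʳ (Δ-ι k) ⟩
        (ι k ⊗ 1#) T.+ S ps              T.≈⟨ T.+-congʳ (⊗-cong (sym π₀x≈ιk) refl) ⟩
        (π 0 x ⊗ 1#) T.+ S ps            T.∎
      counit : contract A (π 0) ((π 0 x , 1#) ∷ ps) ≈ x
      counit = begin
        π 0 x * π 0 1# + contract A (π 0) ps  ≈⟨ +-cong (trans (*-congˡ 1#∈A₀) (*-identityʳ _)) counit₊ ⟩
        π 0 x + (x - π 0 x)                   ≈⟨ sym (x≈y+[x-y] A x (π 0 x)) ⟩
        x                                     ∎

mainTheorem3 : ∀ {c ℓ a ℓa t ℓt : Level}
    (F : CommutativeRing c ℓ) → IsField F →
    (A : CommAlgebra F a ℓa) →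
    (π : ℕ → CommAlgebra.Carrier A → CommAlgebra.Carrier A) →
    (g : CommAlgebra.Carrier A) →
    IsConnectedFilteredGraded A π g →
    (T : CommAlgebra F t ℓt) →
    (_⊗_ : CommAlgebra.Carrier A → CommAlgebra.Carrier A → CommAlgebra.Carrier T) →
    IsTensorSquare A T _⊗_ →
    (Δ : CommAlgebra.Carrier A → CommAlgebra.Carrier T) →
    IsAlgebraHom A T Δ →
    IsPrimitiveModuloA₊⊗A₊ A T _⊗_ π Δ →
    (ξ : CommAlgebra.Carrier T → CommAlgebra.Carrier A) →
    IsLinear T A ξ →
    (∀ p → CommAlgebra._≈_ A (ξ (p ⊗ g)) p) →
    (∀ i p q → i ≢ 1 → InGrade A π i q → CommAlgebra._≈_ A (ξ (p ⊗ q)) (CommAlgebra.0# A)) →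
    IsDerivation A (λ x → ξ (Δ x))
mainTheorem3 F _ A π g G T _⊗_ TS Δ ΔH Δ-primitive ξ ξL ξ-⊗-g ξ-⊗-Aᵢ = record
  { linear  = ∘-linear ξL (algebraHom-linear ΔH)
  ; leibniz = leibniz
  }
  where
  open CommAlgebra A
  open SetoidReasoning setoid
  open PointDerivation G TS ξL ξ-⊗-g ξ-⊗-Aᵢ
  open CounitPresentation G TS ΔH Δ-primitive
  module T = CommAlgebra T
  module ξL = IsLinear ξL
  open RingMorphisms.IsRingHomomorphism (IsAlgebraHom.ring-hom ΔH) using (*-homo)

  S : List (Carrier × Carrier) → T.Carrier
  S = sumPure A T _⊗_ π

  D-contract : ∀ {x} ps → Δ x T.≈ S ps → contract A δ ps ≈ ξ (Δ x)
  D-contract ps Δx≈Sps = sym (trans (ξL.cong Δx≈Sps) (ξ-sumPure ps))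

  leibniz : ∀ x y → ξ (Δ (x * y)) ≈ x * ξ (Δ y) + ξ (Δ x) * y
  leibniz x y with Δ-presentation x | Δ-presentation y
  ... | ps , Δx≈Sps , counitˣ | qs , Δy≈Sqs , counitʸ = begin
    ξ (Δ (x * y))          ≈⟨ ξL.cong (T.trans (*-homo x y) (T.*-cong Δx≈Sps Δy≈Sqs)) ⟩
    ξ (S ps T.* S qs)      ≈⟨ ξ-sumPure-* ps qs ⟩
    contract A (π 0) ps * contract A δ qs + contract A δ ps * contract A (π 0) qs
      ≈⟨ +-cong (*-cong counitˣ (D-contract qs Δy≈Sqs)) (*-cong (D-contract ps Δx≈Sps) counitʸ) ⟩
    x * ξ (Δ y) + ξ (Δ x) * y  ∎
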